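{- Every $2$-probe block graph is distance-hereditary.
   Context: Graphs are finite and simple. A block of a graph is a maximal $2$-connected subgraph (or a bridge or isolated vertex); a block graph is a graph in which every block is a clique. A graph $G=(V,E)$ is a $2$-probe block graph if there exist independent sets $N_1,N_2\subseteq V$ (possibly empty) and a block graph $G'=(V,E')$ with $E\subseteq E'$ such that every edge $xy\in E'\setminus E$ satisfies $x,y\in N_1$ or $x,y\in N_2$. A graph is distance-hereditary if for all vertices $u,v$, every induced path between $u$ and $v$ is a shortest path. -}

module Defs where

open import Data.Nat using (ℕ; _≤_)
open import Data.Bool using (Bool; true; false)
open import Data.Fin using (Fin)
open import Data.Fin.Subset using (Subset; _∈_; _⊆_; Nonempty)
open import Data.List using (List; []; _∷_; head; last; length; drop)
open import Data.List.Relation.Unary.All using (All)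
open import Data.List.Relation.Unary.Unique.Propositional using (Unique)
open import Data.Maybe using (just)
open import Data.Product using (_×_; Σ; ∃)
open import Data.Sum using (_⊎_)
open import Data.Unit using (⊤)
open import Relation.Nullary using (¬_)
open import Relation.Binary.PropositionalEquality using (_≡_; _≢_)

record Graph (n : ℕ) : Set where
  field
    adj    : Fin n → Fin n → Bool
    sym    : ∀ x y → adj x y ≡ adj y x
    irrefl : ∀ x → adj x x ≡ false

module _ {n : ℕ} (G : Graph n) where

  Adj : Fin n → Fin n → Set
  Adj x y = Graph.adj G x y ≡ true

  Linked : List (Fin n) → Set
  Linked []           = ⊤
  Linked (x ∷ [])     = ⊤
  Linked (x ∷ y ∷ xs) = Adj x y × Linked (y ∷ xs)

  WalkBetween : Fin n → Fin n → List (Fin n) → Set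
  WalkBetween u v w = Linked w × head w ≡ just u × last w ≡ just v

  PathBetween : Fin n → Fin n → List (Fin n) → Set
  PathBetween u v p = WalkBetween u v p × Unique p

  NoChords : List (Fin n) → Set
  NoChords []       = ⊤
  NoChords (x ∷ xs) = All (λ y → ¬ Adj x y) (drop 1 xs) × NoChords xs

  InducedPath : Fin n → Fin n → List (Fin n) → Set
  InducedPath u v p = PathBetween u v p × NoChords p

  -- (the path p has length (length p - 1) edges; comparing list lengths
  --  compares path lengths)
  DistanceHereditary : Set
  DistanceHereditary =
    ∀ u v p → InducedPath u v p → ∀ q → PathBetween u v q → length p ≤ length q

  ConnectedIn : (Fin n → Set) → Set
  ConnectedIn P = ∀ x y → P x → P y →
    Σ (List (Fin n)) λ w → WalkBetween x y w × All P w

  ConnectedNoCut : Subset n → Set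
  ConnectedNoCut B =
    ConnectedIn (λ z → z ∈ B) ×
    (∀ v → v ∈ B → ConnectedIn (λ z → z ∈ B × z ≢ v))

  -- a block: a maximal (nonempty) connected subgraph without a cut vertex
  -- (= maximal 2-connected subgraph, bridge, or isolated vertex)
  IsBlock : Subset n → Set
  IsBlock B = Nonempty B × ConnectedNoCut B ×
    (∀ B′ → B ⊆ B′ → ConnectedNoCut B′ → B′ ⊆ B)

  IsBlockGraph : Set
  IsBlockGraph = ∀ B → IsBlock B → ∀ x y → x ∈ B → y ∈ B → x ≢ y → Adj x y

  Independent : Subset n → Set
  Independent N = ∀ x y → x ∈ N → y ∈ N → ¬ Adj x y

TwoProbeBlock : {n : ℕ} → Graph n → Set
TwoProbeBlock {n} G =
  Σ (Subset n) λ N₁ → Σ (Subset n) λ N₂ → Σ (Graph n) λ G′ →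
    Independent G N₁ × Independent G N₂ × IsBlockGraph G′ ×
    (∀ x y → Adj G x y → Adj G′ x y) ×
    (∀ x y → Adj G′ x y → ¬ Adj G x y → (x ∈ N₁ × y ∈ N₁) ⊎ (x ∈ N₂ × y ∈ N₂))

-- Let P be an induced path and Q any path between the same two vertices, and let z be the
-- first vertex of Q, after the common start x, that lies on P. If z is one of the next two
-- vertices of P, the initial segment of Q to z is no shorter than that of P, and induction
-- on the rest applies. Otherwise the two segments form a cycle of G through the first four
-- vertices of P, which induce a P₄. A cycle of G is a cycle of the block graph G′, hence
-- lies inside one block of G′ and is a clique of G′; so the three non-edges of that P₄ are
-- edges of G′, which the two independent probe sets cannot account for.
module Submission where

open import Defs
open import Data.Bool using (true)
open import Data.Bool.Properties using () renaming (_≟_ to _≟ᵇ_)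
open import Data.Empty using (⊥; ⊥-elim)
open import Data.Fin using (Fin)
open import Data.Fin.Properties using (_≟_)
open import Data.Fin.Subset using (Subset; _⊆_; _⊂_; _⊃_; Nonempty; ⁅_⁆; _∪_)
  renaming (_∈_ to _∈ₛ_; ⊥ to ∅)
open import Data.Fin.Subset.Properties using (_∈?_; x∈⁅x⁆; x∈⁅y⁆⇒x≡y; ∉⊥; x∈p∪q⁺; x∈p∪q⁻)
open import Data.Fin.Subset.Induction using (Acc; acc; ⊃-wellFounded)
open import Data.List using (List; []; _∷_; _++_; [_]; last; length; reverse; foldr)
open import Data.List.Properties using (++-assoc; length-++; reverse-++; unfold-reverse)
open import Data.List.Membership.Propositional using (_∈_; _∉_; lose)
open import Data.List.Membership.Propositional.Properties using (∈-∃++; ∈-++⁺ˡ; ∈-++⁺ʳ; ∈-++⁻)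
open import Data.List.Relation.Unary.All using (All; []; _∷_)
  renaming (tabulate to All-tabulate; lookup to All-lookup)
open import Data.List.Relation.Unary.All.Properties using (All¬⇒¬Any) renaming (++⁻ˡ to All-++⁻ˡ)
open import Data.List.Relation.Unary.AllPairs using (AllPairs; []; _∷_)
open import Data.List.Relation.Unary.Any using (Any; here; there)
open import Data.List.Relation.Unary.First using (first; FirstView) renaming (_++_∷_ to hitAt)
open import Data.List.Relation.Unary.First.Properties using (toView)
open import Data.List.Relation.Unary.Unique.Propositional using (Unique)
open import Data.List.Relation.Unary.Unique.Propositional.Properties using (Unique[x∷xs]⇒x∉xs)
  renaming (++⁺ to Unique-++⁺)
open import Data.List.Relation.Binary.Permutation.Propositional using (_↭_; refl; prep; ↭-sym; ↭⇒↭ₛ)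
open import Data.List.Relation.Binary.Permutation.Propositional.Properties
  using (↭-reverse; ++-comm; ++⁺ˡ; ∈-resp-↭)
import Data.List.Relation.Binary.Permutation.Setoid.Properties as Permutationₛ
open import Data.Maybe using (just)
open import Data.Nat using (ℕ; suc; _≤_; z≤n; s≤s)
open import Data.Nat.Properties using (≤-trans; m≤n+m)
open import Data.Product using (_×_; Σ; ∃; _,_; proj₁; proj₂)
open import Data.Sum using (_⊎_; inj₁; inj₂; swap)
open import Data.Unit using (tt)
open import Function using (id; _∘_)
open import Relation.Nullary using (¬_; yes; no; contradiction)
open import Relation.Nullary.Decidable using (decidable-stable; ¬¬-excluded-middle; toSum)
open import Relation.Unary using (Decidable)
open import Relation.Binary.PropositionalEquality using (_≡_; _≢_; refl; sym; trans; cong; subst)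
open import Relation.Binary.PropositionalEquality.Properties using (setoid)

module _ {A : Set} where

  ∈-last : ∀ {v : A} xs → last xs ≡ just v → v ∈ xs
  ∈-last (x ∷ [])     refl = here refl
  ∈-last (x ∷ y ∷ xs) e    = there (∈-last (y ∷ xs) e)

  last-∷ : ∀ (x : A) xs → ∃ λ v → last (x ∷ xs) ≡ just v
  last-∷ x []       = x , refl
  last-∷ x (y ∷ xs) = last-∷ y xs

  last-++ : ∀ xs (z : A) ys → last (xs ++ z ∷ ys) ≡ last (z ∷ ys)
  last-++ []           z ys = refl
  last-++ (x ∷ [])     z ys = refl
  last-++ (x ∷ y ∷ xs) z ys = last-++ (y ∷ xs) z ys

  detour-length : ∀ m {z : A} r {k} → k ≤ length r → suc k ≤ length (m ++ z ∷ r)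
  detour-length m r k≤r =
    subst (suc _ ≤_) (sym (length-++ m)) (≤-trans (s≤s k≤r) (m≤n+m _ (length m)))

  AllPairs-++⁻ˡ : ∀ {R : A → A → Set} xs {ys} → AllPairs R (xs ++ ys) → AllPairs R xs
  AllPairs-++⁻ˡ []       _          = []
  AllPairs-++⁻ˡ (x ∷ xs) (rx ∷ rxs) = All-++⁻ˡ xs rx ∷ AllPairs-++⁻ˡ xs rxs

  AllPairs-++⁻ʳ : ∀ {R : A → A → Set} xs {ys} → AllPairs R (xs ++ ys) → AllPairs R ys
  AllPairs-++⁻ʳ []       rs         = rs
  AllPairs-++⁻ʳ (x ∷ xs) (_ ∷ rxs) = AllPairs-++⁻ʳ xs rxs

  Unique-resp-↭ : ∀ {xs ys : List A} → xs ↭ ys → Unique xs → Unique ys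
  Unique-resp-↭ π = Permutationₛ.Unique-resp-↭ (setoid A) (↭⇒↭ₛ π)

  firstHit : ∀ {P : A → Set} {xs} → Decidable P → Any P xs → FirstView (¬_ ∘ P) P xs
  firstHit P? hit with first (swap ∘ toSum ∘ P?) _
  ... | inj₁ f     = toView f
  ... | inj₂ none  = contradiction hit (All¬⇒¬Any none)

fromList : ∀ {n} → List (Fin n) → Subset n
fromList = foldr (λ x S → ⁅ x ⁆ ∪ S) ∅

∈-fromList⁺ : ∀ {n} {x : Fin n} {xs} → x ∈ xs → x ∈ₛ fromList xs
∈-fromList⁺ (here refl) = x∈p∪q⁺ (inj₁ (x∈⁅x⁆ _))
∈-fromList⁺ (there x∈) = x∈p∪q⁺ (inj₂ (∈-fromList⁺ x∈))

∈-fromList⁻ : ∀ {n} {x : Fin n} xs → x ∈ₛ fromList xs → x ∈ xs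
∈-fromList⁻ (y ∷ xs) x∈ with x∈p∪q⁻ ⁅ y ⁆ (fromList xs) x∈
... | inj₁ x∈y  = here (x∈⁅y⁆⇒x≡y y x∈y)
... | inj₂ x∈xs = there (∈-fromList⁻ xs x∈xs)
∈-fromList⁻ []       x∈ = contradiction x∈ ∉⊥

module _ {n : ℕ} (H : Graph n) where

  adj-sym : ∀ {x y} → Adj H x y → Adj H y x
  adj-sym {x} {y} = trans (Graph.sym H y x)

  Linked-tail : ∀ {x xs} → Linked H (x ∷ xs) → Linked H xs
  Linked-tail {xs = []}    _       = tt
  Linked-tail {xs = _ ∷ _} (_ , l) = l

  Linked-++⁻ˡ : ∀ xs {ys} → Linked H (xs ++ ys) → Linked H xs
  Linked-++⁻ˡ []           _       = tt
  Linked-++⁻ˡ (x ∷ [])     _       = tt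
  Linked-++⁻ˡ (x ∷ y ∷ xs) (a , l) = a , Linked-++⁻ˡ (y ∷ xs) l

  Linked-++⁻ʳ : ∀ xs {ys} → Linked H (xs ++ ys) → Linked H ys
  Linked-++⁻ʳ []       l = l
  Linked-++⁻ʳ (x ∷ xs) l = Linked-++⁻ʳ xs (Linked-tail l)

  Linked-++⁺ : ∀ xs {z ys} → Linked H (xs ++ [ z ]) → Linked H (z ∷ ys) → Linked H (xs ++ z ∷ ys)
  Linked-++⁺ []           _       l = l
  Linked-++⁺ (x ∷ [])     (a , _) l = a , l
  Linked-++⁺ (x ∷ y ∷ xs) (a , k) l = a , Linked-++⁺ (y ∷ xs) k l

  Linked-reverse : ∀ xs → Linked H xs → Linked H (reverse xs)
  Linked-reverse []           _       = tt
  Linked-reverse (x ∷ [])     _       = tt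
  Linked-reverse (x ∷ y ∷ xs) (a , l) =
    subst (Linked H) (sym (reverse-++ (x ∷ y ∷ []) xs))
      (Linked-++⁺ (reverse xs) (subst (Linked H) (unfold-reverse y xs) (Linked-reverse (y ∷ xs) l))
        (adj-sym a , tt))

  IsPath : List (Fin n) → Set
  IsPath p = Linked H p × Unique p

  IsInducedPath : List (Fin n) → Set
  IsInducedPath p = IsPath p × NoChords H p

  -- A two-vertex list [x, y] (an edge walked there and back) also counts as a cycle.
  IsCycle : List (Fin n) → Set
  IsCycle []      = ⊥
  IsCycle (x ∷ l) = Linked H (x ∷ l ++ [ x ]) × Unique (x ∷ l)

  IsPath-suffix : ∀ xs {ys} → IsPath (xs ++ ys) → IsPath ys
  IsPath-suffix xs (l , u) = Linked-++⁻ʳ xs l , AllPairs-++⁻ʳ xs u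

  IsInducedPath-tail : ∀ {x xs} → IsInducedPath (x ∷ xs) → IsInducedPath xs
  IsInducedPath-tail ((l , _ ∷ u) , _ , nc) = (Linked-tail l , u) , nc

  InducedP₄ : Fin n → Fin n → Fin n → Fin n → Set
  InducedP₄ a b c d = Adj H a b × Adj H b c × Adj H c d × ¬ Adj H a c × ¬ Adj H b d × ¬ Adj H a d

  NoCycleThroughInducedP₄ : Set
  NoCycleThroughInducedP₄ =
    ∀ C → IsCycle C → ∀ {a b c d} → All (_∈ C) (a ∷ b ∷ c ∷ d ∷ []) → ¬ InducedP₄ a b c d

  inducedPath⇒InducedP₄ : ∀ {a b c d rest} → IsInducedPath (a ∷ b ∷ c ∷ d ∷ rest) →
                          InducedP₄ a b c d
  inducedPath⇒InducedP₄ (((ab , bc , cd , _) , _) , (¬ac ∷ ¬ad ∷ _) , (¬bd ∷ _) , _) =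
    ab , bc , cd , ¬ac , ¬bd , ¬ad

  twoPaths⇒cycle : ∀ {x p z q} → Linked H (x ∷ p ++ [ z ]) → Linked H (x ∷ q ++ [ z ]) →
                   Unique (x ∷ p ++ z ∷ q) → IsCycle (x ∷ p ++ z ∷ reverse q)
  twoPaths⇒cycle {x} {p} {z} {q} Lp Lq U =
    closed , Unique-resp-↭ (prep x (++⁺ˡ p (prep z (↭-sym (↭-reverse q))))) U
    where
    reverse-q : reverse (x ∷ q ++ [ z ]) ≡ z ∷ reverse q ++ [ x ]
    reverse-q = trans (reverse-++ (x ∷ q) [ z ]) (cong (z ∷_) (unfold-reverse x q))
    closed : Linked H (x ∷ (p ++ z ∷ reverse q) ++ [ x ])
    closed = subst (λ t → Linked H (x ∷ t)) (sym (++-assoc p (z ∷ reverse q) [ x ]))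
      (Linked-++⁺ (x ∷ p) Lp (subst (Linked H) reverse-q (Linked-reverse _ Lq)))

  detour⇒cycle : ∀ {x p z b m r} → IsPath (x ∷ p ++ z ∷ b) → IsPath (x ∷ m ++ z ∷ r) →
                 All (_∉ p ++ z ∷ b) m → IsCycle (x ∷ p ++ z ∷ reverse m)
  detour⇒cycle {x} {p} {z} {b} {m} (LP , UP) (LQ , UQ) m∉P =
    twoPaths⇒cycle (upTo-z (x ∷ p) LP) (upTo-z (x ∷ m) LQ)
      (subst Unique (++-assoc (x ∷ p) [ z ] m)
        (Unique-++⁺ prefixP (AllPairs-++⁻ˡ m (AllPairs-++⁻ʳ [ x ] UQ)) disjoint))
    where
    upTo-z : ∀ xs {ys} → Linked H (xs ++ z ∷ ys) → Linked H (xs ++ [ z ])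
    upTo-z xs {ys} l = Linked-++⁻ˡ (xs ++ [ z ]) (subst (Linked H) (sym (++-assoc xs [ z ] ys)) l)
    prefixP : Unique (x ∷ p ++ [ z ])
    prefixP = AllPairs-++⁻ˡ (x ∷ p ++ [ z ]) (subst Unique (sym (++-assoc (x ∷ p) [ z ] b)) UP)
    disjoint : ∀ {v} → v ∈ x ∷ p ++ [ z ] × v ∈ m → ⊥
    disjoint (here refl , x∈m) = Unique[x∷xs]⇒x∉xs UQ (∈-++⁺ˡ x∈m)
    disjoint (there v∈ , v∈m) with ∈-++⁻ p v∈
    ... | inj₁ v∈p        = All-lookup m∉P v∈m (∈-++⁺ˡ v∈p)
    ... | inj₂ (here v≡z) = All-lookup m∉P v∈m (∈-++⁺ʳ p (here v≡z))

  data WalkIn (P : Fin n → Set) : Fin n → Fin n → Set where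
    stop : ∀ {x} → P x → WalkIn P x x
    step : ∀ {x y z} → P x → Adj H x y → WalkIn P y z → WalkIn P x z

  module _ {P : Fin n → Set} where

    WalkIn-start : ∀ {x y} → WalkIn P x y → P x
    WalkIn-start (stop px)     = px
    WalkIn-start (step px _ _) = px

    WalkIn-trans : ∀ {x y z} → WalkIn P x y → WalkIn P y z → WalkIn P x z
    WalkIn-trans (stop _)      w′ = w′
    WalkIn-trans (step px a w) w′ = step px a (WalkIn-trans w w′)

    WalkIn-sym : ∀ {x y} → WalkIn P x y → WalkIn P y x
    WalkIn-sym (stop px)     = stop px
    WalkIn-sym (step px a w) = WalkIn-trans (WalkIn-sym w) (step (WalkIn-start w) (adj-sym a) (stop px))

    WalkIn⇒walk : ∀ {x y} → WalkIn P x y → Σ (List (Fin n)) λ w → WalkBetween H x y w × All P w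
    WalkIn⇒walk {x} (stop px) = x ∷ [] , (tt , refl , refl) , px ∷ []
    WalkIn⇒walk {x} (step px a w) with WalkIn⇒walk w
    ... | y ∷ ys , (l , refl , e) , ps = x ∷ y ∷ ys , ((a , l) , refl , e) , px ∷ ps

    WalkIn-fromHead : ∀ {h a xs} → Linked H (h ∷ xs) → All P (h ∷ xs) → a ∈ h ∷ xs → WalkIn P h a
    WalkIn-fromHead             _       (ph ∷ _)  (here refl) = stop ph
    WalkIn-fromHead {xs = _ ∷ _} (a , l) (ph ∷ ps) (there a∈) = step ph a (WalkIn-fromHead l ps a∈)

    linked⇒connectedIn : ∀ xs → Linked H xs → All P xs → (∀ {a} → P a → a ∈ xs) → ConnectedIn H P
    linked⇒connectedIn [] _ _ covers a _ pa _ with covers pa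
    ... | ()
    linked⇒connectedIn (h ∷ xs) l ps covers a b pa pb =
      WalkIn⇒walk (WalkIn-trans (WalkIn-sym (WalkIn-fromHead l ps (covers pa)))
                                (WalkIn-fromHead l ps (covers pb)))

  rotate : ∀ x l {w} → Linked H (x ∷ l ++ [ x ]) → w ∈ x ∷ l → ∃ λ r → Linked H r × x ∷ l ↭ w ∷ r
  rotate x l closed (here refl) = l , Linked-++⁻ˡ l (Linked-tail closed) , refl
  rotate x l {w} closed (there w∈l) with ∈-∃++ w∈l
  ... | α , β , refl =
    β ++ x ∷ α ,
    Linked-++⁺ β (Linked-tail (Linked-++⁻ʳ (x ∷ α) closed′)) (Linked-++⁻ˡ (x ∷ α) closed′) ,
    ++-comm (x ∷ α) (w ∷ β)
    where
    closed′ : Linked H ((x ∷ α) ++ w ∷ β ++ [ x ])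
    closed′ = subst (λ t → Linked H (x ∷ t)) (++-assoc α (w ∷ β) [ x ]) closed

  cycle⇒connectedNoCut : ∀ C → IsCycle C → ConnectedNoCut H (fromList C)
  cycle⇒connectedNoCut (x ∷ l) (closed , U) =
    linked⇒connectedIn (x ∷ l) (Linked-++⁻ˡ (x ∷ l) closed) (All-tabulate ∈-fromList⁺) (∈-fromList⁻ _) ,
    noCut
    where
    noCut : ∀ v → v ∈ₛ fromList (x ∷ l) → ConnectedIn H (λ z → z ∈ₛ fromList (x ∷ l) × z ≢ v)
    noCut v v∈ with rotate x l closed (∈-fromList⁻ _ v∈)
    ... | r , Lr , π = linked⇒connectedIn r Lr (All-tabulate kept) covers
      where
      v∉r : v ∉ r
      v∉r = Unique[x∷xs]⇒x∉xs (Unique-resp-↭ π U)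
      kept : ∀ {z} → z ∈ r → z ∈ₛ fromList (x ∷ l) × z ≢ v
      kept z∈r = ∈-fromList⁺ (∈-resp-↭ (↭-sym π) (there z∈r)) , λ { refl → v∉r z∈r }
      covers : ∀ {z} → z ∈ₛ fromList (x ∷ l) × z ≢ v → z ∈ r
      covers (z∈ , z≢v) with ∈-resp-↭ π (∈-fromList⁻ _ z∈)
      ... | here z≡v  = contradiction z≡v z≢v
      ... | there z∈r = z∈r

  p⊆q⇒p⊄q⇒q⊆p : ∀ {p q : Subset n} → p ⊆ q → ¬ p ⊂ q → q ⊆ p
  p⊆q⇒p⊄q⇒q⊆p {p} p⊆q p⊄q {x} x∈q with x ∈? p
  ... | yes x∈p = x∈p
  ... | no  x∉p = contradiction ((λ {y} → p⊆q {y}) , x , x∈q , x∉p) p⊄q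

  -- ConnectedNoCut is not decided here, so a maximal superset is only found under double
  -- negation; connectedNoCut⇒clique removes it again because adjacency is decidable.
  blockAbove : ∀ S → Acc _⊃_ S → Nonempty S → ConnectedNoCut H S →
               ¬ ¬ (∃ λ B → IsBlock H B × S ⊆ B)
  blockAbove S (acc larger) (x , x∈S) cS noBlock =
    ¬¬-excluded-middle {A = ∃ λ B → S ⊂ B × ConnectedNoCut H B} λ where
      (yes (B , S⊂B , cB)) → blockAbove B (larger S⊂B) (x , proj₁ S⊂B x∈S) cB
        λ (B′ , isB′ , B⊆B′) → noBlock (B′ , isB′ , B⊆B′ ∘ proj₁ S⊂B)
      (no noLarger) → noBlock (S , ((x , x∈S) , cS , λ B S⊆B cB →
        p⊆q⇒p⊄q⇒q⊆p S⊆B (λ S⊂B → noLarger (B , S⊂B , cB))) , id)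

  connectedNoCut⇒clique : IsBlockGraph H → ∀ {S x y} → ConnectedNoCut H S →
                          x ∈ₛ S → y ∈ₛ S → x ≢ y → Adj H x y
  connectedNoCut⇒clique blocks {S} {x} {y} cS x∈S y∈S x≢y =
    decidable-stable (Graph.adj H x y ≟ᵇ true) λ ¬xy →
      blockAbove S (⊃-wellFounded S) (x , x∈S) cS λ (B , isB , S⊆B) →
        ¬xy (blocks B isB x y (S⊆B x∈S) (S⊆B y∈S) x≢y)

  cycle⇒clique : IsBlockGraph H → ∀ C → IsCycle C →
                 ∀ {a b} → a ∈ C → b ∈ C → a ≢ b → Adj H a b
  cycle⇒clique blocks C cyc a∈ b∈ =
    connectedNoCut⇒clique blocks (cycle⇒connectedNoCut C cyc) (∈-fromList⁺ a∈) (∈-fromList⁺ b∈)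

module _ {n : ℕ} {G G′ : Graph n} (G⊆G′ : ∀ x y → Adj G x y → Adj G′ x y) where

  Linked-mono : ∀ xs → Linked G xs → Linked G′ xs
  Linked-mono []           _       = tt
  Linked-mono (x ∷ [])     _       = tt
  Linked-mono (x ∷ y ∷ xs) (a , l) = G⊆G′ x y a , Linked-mono (y ∷ xs) l

  IsCycle-mono : ∀ C → IsCycle G C → IsCycle G′ C
  IsCycle-mono (x ∷ l) (closed , U) = Linked-mono _ closed , U

module _ {n : ℕ} {G G′ : Graph n} {N₁ N₂ : Subset n}
         (indep₁ : Independent G N₁) (indep₂ : Independent G N₂)
         (probe : ∀ x y → Adj G′ x y → ¬ Adj G x y →
                  (x ∈ₛ N₁ × y ∈ₛ N₁) ⊎ (x ∈ₛ N₂ × y ∈ₛ N₂))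
         where

  -- The non-edges ac, bd, ad of G lie in N₁ or N₂. If ac and bd lie in the same Nᵢ, then
  -- so does the edge ab; otherwise ad shares its Nᵢ with ac (and then cd lies in it) or
  -- with bd (and then ab does).
  inducedP₄-not-clique : ∀ {a b c d} → InducedP₄ G a b c d →
                         Adj G′ a c → Adj G′ b d → Adj G′ a d → ⊥
  inducedP₄-not-clique (ab , bc , cd , ¬ac , ¬bd , ¬ad) ac bd ad
    with probe _ _ ac ¬ac | probe _ _ bd ¬bd | probe _ _ ad ¬ad
  ... | inj₁ (a₁ , _)  | inj₁ (b₁ , _)  | _              = indep₁ _ _ a₁ b₁ ab
  ... | inj₂ (a₂ , _)  | inj₂ (b₂ , _)  | _              = indep₂ _ _ a₂ b₂ ab
  ... | inj₁ (_ , c₁)  | inj₂ _         | inj₁ (_ , d₁)  = indep₁ _ _ c₁ d₁ cd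
  ... | inj₁ _         | inj₂ (b₂ , _)  | inj₂ (a₂ , _)  = indep₂ _ _ a₂ b₂ ab
  ... | inj₂ (_ , c₂)  | inj₁ _         | inj₂ (_ , d₂)  = indep₂ _ _ c₂ d₂ cd
  ... | inj₂ _         | inj₁ (b₁ , _)  | inj₁ (a₁ , _)  = indep₁ _ _ a₁ b₁ ab

twoProbeBlock⇒noCycleThroughInducedP₄ : ∀ {n} {G : Graph n} → TwoProbeBlock G →
                                        NoCycleThroughInducedP₄ G
twoProbeBlock⇒noCycleThroughInducedP₄ {G = G} (N₁ , N₂ , G′ , indep₁ , indep₂ , blocks , G⊆G′ , probe)
  C cyc {a} {b} {c} {d} (a∈ ∷ b∈ ∷ c∈ ∷ d∈ ∷ []) p₄@(ab , _ , cd , ¬ac , _ , ¬ad) =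
  inducedP₄-not-clique {G = G} {G′ = G′} indep₁ indep₂ probe p₄
    (clique a∈ c∈ a≢c) (clique b∈ d∈ b≢d) (clique a∈ d∈ a≢d)
  where
  clique : ∀ {u v} → u ∈ C → v ∈ C → u ≢ v → Adj G′ u v
  clique = cycle⇒clique G′ blocks C (IsCycle-mono G⊆G′ C cyc)
  a≢c : a ≢ c
  a≢c refl = ¬ad cd
  b≢d : b ≢ d
  b≢d refl = ¬ad ab
  a≢d : a ≢ d
  a≢d refl = ¬ac (adj-sym G cd)

module _ {n : ℕ} (G : Graph n) (noCycleP₄ : NoCycleThroughInducedP₄ G) where

  open import Data.List.Membership.DecPropositional (_≟_ {n}) using () renaming (_∈?_ to _∈ₗ?_)

  no-cycle-starts-along-inducedPath : ∀ {a b c d rest rest′} → IsCycle G (a ∷ b ∷ c ∷ d ∷ rest) →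
                                      ¬ IsInducedPath G (a ∷ b ∷ c ∷ d ∷ rest′)
  no-cycle-starts-along-inducedPath cyc P = noCycleP₄ _ cyc
    (here refl ∷ there (here refl) ∷ there (there (here refl)) ∷ there (there (there (here refl))) ∷ [])
    (inducedPath⇒InducedP₄ G P)

  no-far-firstHit : ∀ x y w xs m z r → IsInducedPath G (x ∷ y ∷ w ∷ xs) → IsPath G (x ∷ m ++ z ∷ r) →
           All (_∉ y ∷ w ∷ xs) m → z ∈ xs → ⊥
  no-far-firstHit x y w xs m z r P Q m∉P z∈ with ∈-∃++ z∈
  ... | []    , b , refl =
    no-cycle-starts-along-inducedPath (detour⇒cycle G {p = y ∷ w ∷ []} (proj₁ P) Q m∉P) P
  ... | t ∷ A , b , refl =
    no-cycle-starts-along-inducedPath (detour⇒cycle G {p = y ∷ w ∷ t ∷ A} (proj₁ P) Q m∉P) P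

  mutual
    inducedPath-shortest : ∀ x xs ys → IsInducedPath G (x ∷ xs) → IsPath G (x ∷ ys) →
                           last (x ∷ xs) ≡ last (x ∷ ys) → length xs ≤ length ys
    inducedPath-shortest x []       ys _ _ _ = z≤n
    inducedPath-shortest x (y ∷ xs) ys P Q e with firstHit (_∈ₗ? y ∷ xs) hit
      where
      hit : Any (_∈ y ∷ xs) ys
      hit with last-∷ y xs
      ... | v , ev with ∈-last (x ∷ ys) (trans (sym e) ev)
      ...   | here refl = contradiction (∈-last (y ∷ xs) ev) (Unique[x∷xs]⇒x∉xs (proj₂ (proj₁ P)))
      ...   | there v∈ys = lose v∈ys (∈-last (y ∷ xs) ev)
    ... | hitAt {m} {z} m∉P z∈P r =
      shortest-via-firstHit x y xs m z r P Q m∉P z∈P (trans e (last-++ (x ∷ m) z r))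

    shortest-via-firstHit : ∀ x y xs m z r →
                            IsInducedPath G (x ∷ y ∷ xs) → IsPath G (x ∷ m ++ z ∷ r) →
                            All (_∉ y ∷ xs) m → z ∈ y ∷ xs → last (y ∷ xs) ≡ last (z ∷ r) →
                            length (y ∷ xs) ≤ length (m ++ z ∷ r)
    shortest-via-firstHit x y xs m z r P Q _ (here refl) e =
      detour-length m r
        (inducedPath-shortest y xs r (IsInducedPath-tail G P) (IsPath-suffix G (x ∷ m) Q) e)
    shortest-via-firstHit x y (z ∷ b) [] z r (_ , (¬xz ∷ _) , _) ((xz , _) , _) _ (there (here refl)) _ =
      contradiction xz ¬xz
    shortest-via-firstHit x y (z ∷ b) (u ∷ m) z r P Q _ (there (here refl)) e =
      s≤s (detour-length m r
        (inducedPath-shortest z b r (IsInducedPath-tail G (IsInducedPath-tail G P))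
                                    (IsPath-suffix G (x ∷ u ∷ m) Q) e))
    shortest-via-firstHit x y (w ∷ xs) m z r P Q m∉P (there (there z∈)) _ =
      ⊥-elim (no-far-firstHit x y w xs m z r P Q m∉P z∈)

  noCycleThroughInducedP₄⇒distanceHereditary : DistanceHereditary G
  noCycleThroughInducedP₄⇒distanceHereditary u v [] (((_ , () , _) , _) , _)
  noCycleThroughInducedP₄⇒distanceHereditary u v (x ∷ xs) _ [] ((_ , () , _) , _)
  noCycleThroughInducedP₄⇒distanceHereditary u v
    (x ∷ xs) (((LP , refl , eP) , UP) , NP) (x ∷ ys) ((LQ , refl , eQ) , UQ) =
    s≤s (inducedPath-shortest x xs ys ((LP , UP) , NP) (LQ , UQ) (trans eP (sym eQ)))

corollary3 : (n : ℕ) (G : Graph n) → TwoProbeBlock G → DistanceHereditary G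
corollary3 n G twoProbe =
  noCycleThroughInducedP₄⇒distanceHereditary G (twoProbeBlock⇒noCycleThroughInducedP₄ twoProbe)
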